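{- Let $n\ge1$ and let $P_n$ be the path with $n+1$ vertices and edges labelled $1,\ldots,n$ consecutively along the path (edge $i$ joins the $i$th and $(i+1)$st vertices). Then the set $P(P_n)=\{p_\sigma:\sigma\in O(P_n)\}$ is precisely the set of partial orders on $\{1,\ldots,n\}$ whose Hasse diagram, as an undirected graph, is the path $1-2-\cdots-n$; equivalently, the partial orders obtained as the transitive closure of a choice, for each $1\le i\le n-1$, of either $i<i+1$ or $i+1<i$.
   Context: $O(P_n)$ is the set of orderings of the edges (sequences listing every edge exactly once), each identified with the corresponding linear order on the edge set. For an ordering $\sigma$ and vertex $v$, $\sigma|_v$ is the restriction of $\sigma$ to the edges incident with $v$, and $p_\sigma$ is the transitive closure of $\bigcup_v\sigma|_v$. -}

module Defs where

open import Level using (0ℓ)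
open import Data.Nat using (ℕ; suc; _<_)
open import Data.Fin using (Fin; toℕ)
open import Data.Fin.Permutation using (Permutation′; _⟨$⟩ʳ_)
open import Data.Bool using (Bool; true; false)
open import Data.Product using (Σ; ∃; _×_)
open import Data.Sum using (_⊎_)
open import Relation.Nullary using (¬_)
open import Relation.Binary.Core using (Rel)
open import Relation.Binary.Structures using (IsStrictPartialOrder)
open import Relation.Binary.PropositionalEquality using (_≡_)
open import Relation.Binary.Construct.Closure.Transitive using (TransClosure)

-- Path P_n: vertices Fin (suc n) (0-indexed), edges Fin n;
-- edge e (0-indexed, i.e. paper's label toℕ e + 1) joins vertices e and e+1.
Incident : {n : ℕ} → Fin (suc n) → Fin n → Set
Incident v e = (toℕ v ≡ toℕ e) ⊎ (toℕ v ≡ suc (toℕ e))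

-- An ordering σ ∈ O(P_n): a bijection edges → positions (σ ⟨$⟩ʳ e is the
-- position of edge e in the sequence); the induced strict linear order.
Ordering : ℕ → Set
Ordering n = Permutation′ n

_<[_]_ : {n : ℕ} → Fin n → Ordering n → Fin n → Set
e <[ σ ] f = toℕ (σ ⟨$⟩ʳ e) < toℕ (σ ⟨$⟩ʳ f)

restrict : {n : ℕ} → Ordering n → Fin (suc n) → Rel (Fin n) 0ℓ
restrict σ v e f = Incident v e × Incident v f × (e <[ σ ] f)

unionRestrict : {n : ℕ} → Ordering n → Rel (Fin n) 0ℓ
unionRestrict {n} σ e f = Σ (Fin (suc n)) λ v → restrict σ v e f

p : {n : ℕ} → Ordering n → Rel (Fin n) 0ℓ
p σ = TransClosure (unionRestrict σ)

_≐_ : {n : ℕ} → Rel (Fin n) 0ℓ → Rel (Fin n) 0ℓ → Set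
_≐_ {n} R S = (x y : Fin n) → (R x y → S x y) × (S x y → R x y)

Covers : {n : ℕ} → Rel (Fin n) 0ℓ → Fin n → Fin n → Set
Covers {n} R x y = R x y × ¬ (Σ (Fin n) λ z → R x z × R z y)

PathAdj : {n : ℕ} → Fin n → Fin n → Set
PathAdj x y = (toℕ y ≡ suc (toℕ x)) ⊎ (toℕ x ≡ suc (toℕ y))

HassePathOrder : {n : ℕ} → Rel (Fin n) 0ℓ → Set
HassePathOrder {n} R =
  IsStrictPartialOrder _≡_ R
  × ((x y : Fin n) → ((Covers R x y ⊎ Covers R y x) → PathAdj x y)
                    × (PathAdj x y → (Covers R x y ⊎ Covers R y x)))

-- a choice, for each consecutive pair (i, i+1), of i < i+1 (true) or i+1 < i (false);
-- the value at the last element is irrelevant.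
ChoiceRel : {n : ℕ} → (Fin n → Bool) → Rel (Fin n) 0ℓ
ChoiceRel c x y = ((toℕ y ≡ suc (toℕ x)) × (c x ≡ true))
                ⊎ ((toℕ x ≡ suc (toℕ y)) × (c y ≡ false))

InPP : {n : ℕ} → Rel (Fin n) 0ℓ → Set
InPP {n} R = Σ (Ordering n) λ σ → R ≐ p σ

-- A choice c orients each pair of consecutive edges, and the transitive closure
-- of these orientations is explicit: x lies below y exactly when all edges from
-- x towards y are oriented in that direction (a monotone run).  Runs compose,
-- cannot meet head-on, and split at every intermediate edge, so the closure is a
-- strict order whose covering pairs are the consecutive ones.  Conversely, if
-- the Hasse diagram of R is the path, then R x y yields a run from x to y by
-- well-founded induction: a cover is a consecutive pair, and otherwise R x y
-- factors through some z.  Finally, two edges of P_n share a vertex exactly when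
-- they are consecutive, so p_σ is the closure of the orientations read off σ;
-- and every choice is realised by inserting edge 0 first or last into an
-- ordering of the remaining edges.
module Submission where

open import Defs
open import Level using (0ℓ)
open import Data.Nat using (ℕ; zero; suc; s≤s⁻¹; _≤_; _<_; _+_; _∸_; z≤n; s≤s; _<?_; _≤?_)
open import Data.Nat.Properties
  using (≤-refl; ≤-reflexive; ≤-trans; ≤-<-trans; ≤-antisym; <-trans; <-irrefl; <-asym;
         <⇒≤; <⇒≱; ≰⇒>; ≮⇒≥; ≤∧≢⇒<; <-cmp; 1+n≢n; suc-injective; +-suc; m≤n+m; m∸n+n≡m)
  renaming (_≟_ to _ℕ≟_)
open import Data.Fin using (Fin; toℕ; fromℕ; fromℕ<; punchIn)
  renaming (zero to fzero; suc to fsuc)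
open import Data.Fin.Properties
  using (toℕ-injective; toℕ-fromℕ<; toℕ<n; ≤fromℕ; all?; punchInᵢ≢i; punchIn-cancel-≤)
open import Data.Fin.Permutation using (_⟨$⟩ʳ_; insert; insert-punchIn; id)
open import Data.Fin.Induction using (spo-wellFounded; spo-noetherian)
open import Data.Bool using (Bool; true; false)
open import Data.Bool.Properties using (¬-not) renaming (_≟_ to _𝔹≟_)
open import Data.Product using (Σ; ∃; _×_; _,_; proj₁; proj₂)
open import Data.Sum using (_⊎_; inj₁; inj₂; [_,_]′)
import Data.Sum as Sum
open import Data.Empty using (⊥-elim)
open import Function using (_∘_; flip)
open import Function.Bundles using (Injection)
open import Function.Properties.Inverse using (↔⇒↣)
open import Relation.Nullary using (¬_; Dec; yes; no; contradiction)
open import Relation.Nullary.Decidable using (decidable-stable; map′; _×-dec_; _→-dec_; _⊎-dec_)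
open import Relation.Binary.Core using (Rel; _⇒_)
open import Relation.Binary.Definitions using (Asymmetric; tri<; tri≈; tri>)
open import Relation.Binary.Structures using (IsStrictPartialOrder)
open import Relation.Binary.PropositionalEquality
open import Relation.Binary.Construct.Closure.Transitive using (TransClosure; [_]; _∷_; _∷ʳ_; transitive⁻)
open import Induction.WellFounded using (Acc; acc)

private
  variable
    n : ℕ

TransClosure-map : {A : Set} {R S : Rel A 0ℓ} → R ⇒ S → TransClosure R ⇒ TransClosure S
TransClosure-map f [ r ]    = [ f r ]
TransClosure-map f (r ∷ rs) = f r ∷ TransClosure-map f rs

TransClosure-reverse : {A : Set} {R : Rel A 0ℓ} → flip (TransClosure R) ⇒ TransClosure (flip R)
TransClosure-reverse [ r ]    = [ r ]
TransClosure-reverse (r ∷ rs) = TransClosure-reverse rs ∷ʳ r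

≐-sym : {R S : Rel (Fin n) 0ℓ} → R ≐ S → S ≐ R
≐-sym R≐S x y = proj₂ (R≐S x y) , proj₁ (R≐S x y)

≐-trans : {R S T : Rel (Fin n) 0ℓ} → R ≐ S → S ≐ T → R ≐ T
≐-trans R≐S S≐T x y = proj₁ (S≐T x y) ∘ proj₁ (R≐S x y) , proj₂ (R≐S x y) ∘ proj₂ (S≐T x y)

module _ {R S : Rel (Fin n) 0ℓ} (R≐S : R ≐ S) where

  private
    to : R ⇒ S
    to {x} {y} = proj₁ (R≐S x y)

    from : S ⇒ R
    from {x} {y} = proj₂ (R≐S x y)

  TransClosure-cong : TransClosure R ≐ TransClosure S
  TransClosure-cong x y = TransClosure-map to , TransClosure-map from

  Covers-resp-≐ : Covers R ⇒ Covers S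
  Covers-resp-≐ (r , ∄z) = to r , λ (z , s₁ , s₂) → ∄z (z , from s₁ , from s₂)

  isStrictPartialOrder-resp-≐ : IsStrictPartialOrder _≡_ S → IsStrictPartialOrder _≡_ R
  isStrictPartialOrder-resp-≐ spo = record
    { isEquivalence = isEquivalence
    ; irrefl        = λ x≡y r → S.irrefl x≡y (to r)
    ; trans         = λ r₁ r₂ → from (S.trans (to r₁) (to r₂))
    ; <-resp-≈      = resp₂ R
    }
    where module S = IsStrictPartialOrder spo

HassePathOrder-resp-≐ : {R S : Rel (Fin n) 0ℓ} → R ≐ S → HassePathOrder S → HassePathOrder R
HassePathOrder-resp-≐ R≐S (spo , hasse) =
  isStrictPartialOrder-resp-≐ R≐S spo ,
  λ x y → proj₁ (hasse x y) ∘ Sum.map (Covers-resp-≐ R≐S) (Covers-resp-≐ R≐S)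
        , Sum.map (Covers-resp-≐ (≐-sym R≐S)) (Covers-resp-≐ (≐-sym R≐S)) ∘ proj₂ (hasse x y)

successor : {x y : Fin n} → toℕ x < toℕ y → ∃ λ x′ → toℕ x′ ≡ suc (toℕ x)
successor {n} {x} {y} x<y = fromℕ< x+1<n , toℕ-fromℕ< x+1<n
  where
  x+1<n : suc (toℕ x) < n
  x+1<n = ≤-<-trans x<y (toℕ<n y)

PathAdj-sym : {x y : Fin n} → PathAdj x y → PathAdj y x
PathAdj-sym = Sum.swap

adjacent-no-between : {a b k : ℕ} → (b ≡ suc a) ⊎ (a ≡ suc b) →
  ¬ ((a < k × k < b) ⊎ (b < k × k < a))
adjacent-no-between (inj₁ refl) (inj₁ (a<k , k<b)) = <⇒≱ a<k (s≤s⁻¹ k<b)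
adjacent-no-between (inj₂ refl) (inj₂ (b<k , k<a)) = <⇒≱ b<k (s≤s⁻¹ k<a)
adjacent-no-between (inj₁ refl) (inj₂ (b<k , k<a)) = <-asym (<-trans b<k k<a) ≤-refl
adjacent-no-between (inj₂ refl) (inj₁ (a<k , k<b)) = <-asym (<-trans a<k k<b) ≤-refl

-- Monotone runs of a choice

module _ (c : Fin n → Bool) where

  -- ChoiceRel c x y unfolds to  Step c true x y ⊎ Step c false y x.
  Step : Bool → Rel (Fin n) 0ℓ
  Step b x y = toℕ y ≡ suc (toℕ x) × c x ≡ b

  Run : Bool → Rel (Fin n) 0ℓ
  Run b x y = toℕ x < toℕ y × (∀ k → toℕ x ≤ toℕ k → toℕ k < toℕ y → c k ≡ b)

  Monotone : Rel (Fin n) 0ℓ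
  Monotone x y = Run true x y ⊎ Run false y x

module _ {c : Fin n → Bool} where

  Run-trans : ∀ {b x y z} → Run c b x y → Run c b y z → Run c b x z
  Run-trans {b} {x} {y} {z} (x<y , cxy) (y<z , cyz) = <-trans x<y y<z , const
    where
    const : ∀ k → toℕ x ≤ toℕ k → toℕ k < toℕ z → c k ≡ b
    const k x≤k k<z with toℕ k <? toℕ y
    ... | yes k<y = cxy k x≤k k<y
    ... | no  k≮y = cyz k (≮⇒≥ k≮y) k<z

  Run-split : ∀ {b x y z} → Run c b x z → toℕ x < toℕ y → toℕ y < toℕ z → Run c b x y × Run c b y z
  Run-split (_ , const) x<y y<z =
    (x<y , λ k x≤k k<y → const k x≤k (<-trans k<y y<z)) ,
    (y<z , λ k y≤k k<z → const k (≤-trans (<⇒≤ x<y) y≤k) k<z)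

  Run-refine : ∀ {b x z} → Run c b x z → toℕ z ≢ suc (toℕ x) → ∃ λ y → Run c b x y × Run c b y z
  Run-refine {x = x} {z} run@(x<z , _) z≢x+1 = y , Run-split run x<y y<z
    where
    y : Fin n
    y = proj₁ (successor x<z)
    y≡x+1 : toℕ y ≡ suc (toℕ x)
    y≡x+1 = proj₂ (successor x<z)
    x<y : toℕ x < toℕ y
    x<y = ≤-reflexive (sym y≡x+1)
    y<z : toℕ y < toℕ z
    y<z = ≤∧≢⇒< (subst (_≤ toℕ z) (sym y≡x+1) x<z) (λ y≡z → z≢x+1 (trans (sym y≡z) y≡x+1))

  Run-same-end : ∀ {b b′ x x′ y} → Run c b x y → Run c b′ x′ y → b ≡ b′
  Run-same-end {x = x} {x′} (x<y , const) (x′<y , const′) with toℕ x ≤? toℕ x′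
  ... | yes x≤x′ = trans (sym (const x′ x≤x′ x′<y)) (const′ x′ ≤-refl x′<y)
  ... | no  x≰x′ = trans (sym (const x ≤-refl x<y)) (const′ x (<⇒≤ (≰⇒> x≰x′)) x<y)

  Run-same-start : ∀ {b b′ x y y′} → Run c b x y → Run c b′ x y′ → b ≡ b′
  Run-same-start {x = x} (x<y , const) (x<y′ , const′) =
    trans (sym (const x ≤-refl x<y)) (const′ x ≤-refl x<y′)

  Step⇒Run : ∀ {b} → Step c b ⇒ Run c b
  Step⇒Run {b} {x} {y} (y≡x+1 , cx) = ≤-reflexive (sym y≡x+1) , const
    where
    const : ∀ k → toℕ x ≤ toℕ k → toℕ k < toℕ y → c k ≡ b
    const k x≤k k<y = subst (λ w → c w ≡ b) (toℕ-injective x≡k) cx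
      where
      x≡k : toℕ x ≡ toℕ k
      x≡k = ≤-antisym x≤k (s≤s⁻¹ (subst (suc (toℕ k) ≤_) y≡x+1 k<y))

  Run⇒Steps : ∀ {b} → Run c b ⇒ TransClosure (Step c b)
  Run⇒Steps {x = x} {y} run@(x<y , _) = go (toℕ y ∸ suc (toℕ x)) distance run
    where
    distance : suc (toℕ y ∸ suc (toℕ x) + toℕ x) ≡ toℕ y
    distance = trans (sym (+-suc _ (toℕ x))) (m∸n+n≡m x<y)
    go : ∀ {b x y} d → suc (d + toℕ x) ≡ toℕ y → Run c b x y → TransClosure (Step c b) x y
    go zero    gap (x<y , const) = [ sym gap , const _ ≤-refl x<y ]
    go {x = x} {y} (suc d) gap run@(x<y , const) =
      (x′≡x+1 , const x ≤-refl x<y) ∷ go d gap′ (proj₂ (Run-split run x<x′ x′<y))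
      where
      x′ : Fin n
      x′ = proj₁ (successor x<y)
      x′≡x+1 : toℕ x′ ≡ suc (toℕ x)
      x′≡x+1 = proj₂ (successor x<y)
      gap′ : suc (d + toℕ x′) ≡ toℕ y
      gap′ = trans (cong (λ m → suc (d + m)) x′≡x+1) (trans (cong suc (+-suc d (toℕ x))) gap)
      x<x′ : toℕ x < toℕ x′
      x<x′ = ≤-reflexive (sym x′≡x+1)
      x′<y : toℕ x′ < toℕ y
      x′<y = subst (_< toℕ y) (sym x′≡x+1)
                   (subst (suc (suc (toℕ x)) ≤_) gap (s≤s (s≤s (m≤n+m (toℕ x) d))))

  Run-dec : ∀ b x y → Dec (Run c b x y)
  Run-dec b x y = (toℕ x <? toℕ y) ×-dec
    all? (λ k → (toℕ x ≤? toℕ k) →-dec ((toℕ k <? toℕ y) →-dec (c k 𝔹≟ b)))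

  Monotone-dec : ∀ x y → Dec (Monotone c x y)
  Monotone-dec x y = Run-dec true x y ⊎-dec Run-dec false y x

  Monotone-trans : ∀ {x y z} → Monotone c x y → Monotone c y z → Monotone c x z
  Monotone-trans (inj₁ r) (inj₁ s) = inj₁ (Run-trans r s)
  Monotone-trans (inj₂ r) (inj₂ s) = inj₂ (Run-trans s r)
  Monotone-trans (inj₁ r) (inj₂ s) = contradiction (Run-same-end r s) λ ()
  Monotone-trans (inj₂ r) (inj₁ s) = contradiction (Run-same-start r s) λ ()

  Monotone-irrefl : ∀ {x} → ¬ Monotone c x x
  Monotone-irrefl (inj₁ (x<x , _)) = <-irrefl refl x<x
  Monotone-irrefl (inj₂ (x<x , _)) = <-irrefl refl x<x

  Monotone-isStrictPartialOrder : IsStrictPartialOrder _≡_ (Monotone c)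
  Monotone-isStrictPartialOrder = record
    { isEquivalence = isEquivalence
    ; irrefl        = λ { refl → Monotone-irrefl }
    ; trans         = Monotone-trans
    ; <-resp-≈      = resp₂ (Monotone c)
    }

  Monotone-between : ∀ {x y z} → Monotone c x y → Monotone c y z →
    (toℕ x < toℕ y × toℕ y < toℕ z) ⊎ (toℕ z < toℕ y × toℕ y < toℕ x)
  Monotone-between (inj₁ r) (inj₁ s) = inj₁ (proj₁ r , proj₁ s)
  Monotone-between (inj₂ r) (inj₂ s) = inj₂ (proj₁ s , proj₁ r)
  Monotone-between (inj₁ r) (inj₂ s) = contradiction (Run-same-end r s) λ ()
  Monotone-between (inj₂ r) (inj₁ s) = contradiction (Run-same-start r s) λ ()

  ChoiceRel⇒Monotone : ChoiceRel c ⇒ Monotone c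
  ChoiceRel⇒Monotone = Sum.map Step⇒Run Step⇒Run

  PathAdj⇒ChoiceRel-either : ∀ {x y} → PathAdj x y → ChoiceRel c x y ⊎ ChoiceRel c y x
  PathAdj⇒ChoiceRel-either {x} (inj₁ y≡x+1) with c x 𝔹≟ true
  ... | yes cx = inj₁ (inj₁ (y≡x+1 , cx))
  ... | no  cx = inj₂ (inj₂ (y≡x+1 , ¬-not cx))
  PathAdj⇒ChoiceRel-either {y = y} (inj₂ x≡y+1) with c y 𝔹≟ true
  ... | yes cy = inj₂ (inj₁ (x≡y+1 , cy))
  ... | no  cy = inj₁ (inj₂ (x≡y+1 , ¬-not cy))

  Monotone-adjacent⇒Covers : ∀ {x y} → PathAdj x y → Monotone c x y → Covers (Monotone c) x y
  Monotone-adjacent⇒Covers adj m = m , λ (_ , m₁ , m₂) → adjacent-no-between adj (Monotone-between m₁ m₂)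

  Monotone-Covers⇒adjacent : ∀ {x y} → Covers (Monotone c) x y → PathAdj x y
  Monotone-Covers⇒adjacent {x} {y} (inj₁ r , ∄z) with toℕ y ℕ≟ suc (toℕ x)
  ... | yes y≡x+1 = inj₁ y≡x+1
  ... | no  y≢x+1 with Run-refine r y≢x+1
  ...   | z , r₁ , r₂ = ⊥-elim (∄z (z , inj₁ r₁ , inj₁ r₂))
  Monotone-Covers⇒adjacent {x} {y} (inj₂ r , ∄z) with toℕ x ℕ≟ suc (toℕ y)
  ... | yes x≡y+1 = inj₂ x≡y+1
  ... | no  x≢y+1 with Run-refine r x≢y+1
  ...   | z , r₁ , r₂ = ⊥-elim (∄z (z , inj₂ r₂ , inj₂ r₁))

  Monotone-HassePathOrder : HassePathOrder (Monotone c)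
  Monotone-HassePathOrder = Monotone-isStrictPartialOrder , λ x y →
    [ Monotone-Covers⇒adjacent , PathAdj-sym ∘ Monotone-Covers⇒adjacent ]′ ,
    λ adj → Sum.map (Monotone-adjacent⇒Covers adj ∘ ChoiceRel⇒Monotone)
                    (Monotone-adjacent⇒Covers (PathAdj-sym adj) ∘ ChoiceRel⇒Monotone)
                    (PathAdj⇒ChoiceRel-either adj)

  closure⇒Monotone : TransClosure (ChoiceRel c) ⇒ Monotone c
  closure⇒Monotone [ r ]    = ChoiceRel⇒Monotone r
  closure⇒Monotone (r ∷ rs) = Monotone-trans (ChoiceRel⇒Monotone r) (closure⇒Monotone rs)

  Monotone⇒closure : Monotone c ⇒ TransClosure (ChoiceRel c)
  Monotone⇒closure (inj₁ r) = TransClosure-map inj₁ (Run⇒Steps r)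
  Monotone⇒closure (inj₂ r) = TransClosure-map inj₂ (TransClosure-reverse (Run⇒Steps r))

  closure≐Monotone : TransClosure (ChoiceRel c) ≐ Monotone c
  closure≐Monotone _ _ = closure⇒Monotone , Monotone⇒closure

ChoiceRel-complete : {A : Rel (Fin n) 0ℓ} {c : Fin n → Bool} → Asymmetric A → ChoiceRel c ⇒ A →
  ∀ {x y} → PathAdj x y → A x y → ChoiceRel c x y
ChoiceRel-complete asym c⊆A adj a with PathAdj⇒ChoiceRel-either adj
... | inj₁ r = r
... | inj₂ r = contradiction (c⊆A r) (asym a)

orientation : (A : Rel (Fin n) 0ℓ) → (∀ {x y} → toℕ y ≡ suc (toℕ x) → A x y ⊎ A y x) →
  ∃ λ c → ChoiceRel c ⇒ A
orientation {n} A comparable = c , c⊆A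
  where
  next? : (x : Fin n) → Dec (∃ λ y → toℕ y ≡ suc (toℕ x))
  next? x = map′ (λ x+1<n → fromℕ< x+1<n , toℕ-fromℕ< x+1<n)
                 (λ (y , y≡x+1) → subst (_< n) y≡x+1 (toℕ<n y))
                 (suc (toℕ x) <? n)

  -- the value at the last element is arbitrary
  c : Fin n → Bool
  c x with next? x
  ... | yes (_ , y≡x+1) = [ (λ _ → true) , (λ _ → false) ]′ (comparable y≡x+1)
  ... | no  _           = true

  oriented : ∀ {x y} → toℕ y ≡ suc (toℕ x) → (c x ≡ true → A x y) × (c x ≡ false → A y x)
  oriented {x} {y} y≡x+1 with next? x
  ... | no  ∄y = contradiction (y , y≡x+1) ∄y
  ... | yes (y′ , y′≡x+1) with toℕ-injective (trans y′≡x+1 (sym y≡x+1))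
  ...   | refl with comparable y′≡x+1
  ...     | inj₁ a = (λ _ → a) , λ ()
  ...     | inj₂ a = (λ ()) , λ _ → a

  c⊆A : ChoiceRel c ⇒ A
  c⊆A (inj₁ (y≡x+1 , cx)) = proj₁ (oriented y≡x+1) cx
  c⊆A (inj₂ (x≡y+1 , cy)) = proj₂ (oriented x≡y+1) cy

ChoiceRel≐adjacent : {A : Rel (Fin n) 0ℓ} {c : Fin n → Bool} → Asymmetric A → ChoiceRel c ⇒ A →
  ChoiceRel c ≐ λ x y → PathAdj x y × A x y
ChoiceRel≐adjacent asym c⊆A _ _ =
  (λ r → Sum.map proj₁ proj₁ r , c⊆A r) , λ (adj , a) → ChoiceRel-complete asym c⊆A adj a

-- Orderings of the edges of P_n

unionRestrict≐adjacent : (σ : Ordering n) → unionRestrict σ ≐ λ e f → PathAdj e f × e <[ σ ] f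
unionRestrict≐adjacent σ e f = to , from
  where
  not-below-self : ∀ {e f} → toℕ e ≡ toℕ f → ¬ e <[ σ ] f
  not-below-self e≡f = subst (λ g → ¬ _ <[ σ ] g) (toℕ-injective e≡f) (<-irrefl refl)

  to : unionRestrict σ e f → PathAdj e f × e <[ σ ] f
  to (_ , inj₁ v≡e   , inj₁ v≡f   , lt) = contradiction lt (not-below-self (trans (sym v≡e) v≡f))
  to (_ , inj₁ v≡e   , inj₂ v≡f+1 , lt) = inj₂ (trans (sym v≡e) v≡f+1) , lt
  to (_ , inj₂ v≡e+1 , inj₁ v≡f   , lt) = inj₁ (trans (sym v≡f) v≡e+1) , lt
  to (_ , inj₂ v≡e+1 , inj₂ v≡f+1 , lt) =
    contradiction lt (not-below-self (suc-injective (trans (sym v≡e+1) v≡f+1)))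

  from : PathAdj e f × e <[ σ ] f → unionRestrict σ e f
  from (inj₁ f≡e+1 , lt) = fsuc e , inj₂ refl , inj₁ (sym f≡e+1) , lt
  from (inj₂ e≡f+1 , lt) = fsuc f , inj₁ (sym e≡f+1) , inj₂ refl , lt

p≐closure : (σ : Ordering n) {c : Fin n → Bool} → ChoiceRel c ⇒ _<[ σ ]_ →
  p σ ≐ TransClosure (ChoiceRel c)
p≐closure σ c⊆σ =
  TransClosure-cong (≐-trans (unionRestrict≐adjacent σ) (≐-sym (ChoiceRel≐adjacent <-asym c⊆σ)))

orientationOf : (σ : Ordering n) → ∃ λ c → ChoiceRel c ⇒ _<[ σ ]_
orientationOf σ = orientation _<[ σ ]_ comparable
  where
  comparable : ∀ {x y} → toℕ y ≡ suc (toℕ x) → x <[ σ ] y ⊎ y <[ σ ] x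
  comparable {x} {y} y≡x+1 with <-cmp (toℕ (σ ⟨$⟩ʳ x)) (toℕ (σ ⟨$⟩ʳ y))
  ... | tri< x<y _ _ = inj₁ x<y
  ... | tri> _ _ y<x = inj₂ y<x
  ... | tri≈ _ σx≡σy _ = contradiction (trans (sym y≡x+1) (cong toℕ (sym x≡y))) 1+n≢n
    where
    x≡y : x ≡ y
    x≡y = Injection.injective (↔⇒↣ σ) (toℕ-injective σx≡σy)

punchIn-mono-< : ∀ (i : Fin (suc n)) {j k : Fin n} → toℕ j < toℕ k → toℕ (punchIn i j) < toℕ (punchIn i k)
punchIn-mono-< i {j} {k} j<k = ≰⇒> (λ k′≤j′ → <⇒≱ j<k (punchIn-cancel-≤ i k j k′≤j′))

punchIn-fromℕ-< : (j : Fin n) → toℕ (punchIn (fromℕ n) j) < toℕ (fromℕ n)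
punchIn-fromℕ-< {n} j = ≤∧≢⇒< (≤fromℕ _) (punchInᵢ≢i (fromℕ n) j ∘ toℕ-injective)

orderingOf : (c : Fin n → Bool) → ∃ λ σ → ChoiceRel c ⇒ _<[ σ ]_
orderingOf {zero}  c = id , λ { {()} }
orderingOf {suc n} c = τ (c fzero) , orients
  where
  σ : Ordering n
  σ = proj₁ (orderingOf (c ∘ fsuc))
  σ-orients : ChoiceRel (c ∘ fsuc) ⇒ _<[ σ ]_
  σ-orients = proj₂ (orderingOf (c ∘ fsuc))

  -- edge 0 is placed first when it precedes edge 1, and last otherwise
  slot : Bool → Fin (suc n)
  slot true  = fzero
  slot false = fromℕ n

  τ : Bool → Ordering (suc n)
  τ b = insert fzero (slot b) σ

  τ-suc : ∀ b x → τ b ⟨$⟩ʳ fsuc x ≡ punchIn (slot b) (σ ⟨$⟩ʳ x)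
  τ-suc b = insert-punchIn fzero (slot b) σ

  shift : ∀ b {x y} → x <[ σ ] y → fsuc x <[ τ b ] fsuc y
  shift b {x} {y} x<y =
    subst₂ (λ u w → toℕ u < toℕ w) (sym (τ-suc b x)) (sym (τ-suc b y)) (punchIn-mono-< (slot b) x<y)

  first : ∀ y → fzero <[ τ true ] fsuc y
  first y = subst (λ w → 0 < toℕ w) (sym (τ-suc true y)) (s≤s z≤n)

  last : ∀ x → fsuc x <[ τ false ] fzero
  last x = subst (λ w → toℕ w < toℕ (fromℕ n)) (sym (τ-suc false x)) (punchIn-fromℕ-< (σ ⟨$⟩ʳ x))

  orients : ChoiceRel c ⇒ _<[ τ (c fzero) ]_
  orients {fzero}  {fsuc y} (inj₁ (_ , c0)) = subst (λ b → fzero <[ τ b ] fsuc y) (sym c0) (first y)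
  orients {fsuc x} {fzero}  (inj₂ (_ , c0)) = subst (λ b → fsuc x <[ τ b ] fzero) (sym c0) (last x)
  orients {fsuc x} {fsuc y} (inj₁ (y≡x+1 , cx)) = shift (c fzero) (σ-orients (inj₁ (suc-injective y≡x+1 , cx)))
  orients {fsuc x} {fsuc y} (inj₂ (x≡y+1 , cy)) = shift (c fzero) (σ-orients (inj₂ (suc-injective x≡y+1 , cy)))
  orients {fzero}  {fzero}  (inj₁ (() , _))
  orients {fzero}  {fzero}  (inj₂ (() , _))
  orients {fsuc _} {fzero}  (inj₁ (() , _))
  orients {fzero}  {fsuc _} (inj₂ (() , _))

-- The three descriptions of P(P_n)

IsChoiceClosure : Rel (Fin n) 0ℓ → Set
IsChoiceClosure {n} R = Σ (Fin n → Bool) λ c → R ≐ TransClosure (ChoiceRel c)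

HassePathOrder⇒IsChoiceClosure : {R : Rel (Fin n) 0ℓ} → HassePathOrder R → IsChoiceClosure R
HassePathOrder⇒IsChoiceClosure {n} {R} hasse@(spo , _) = c , λ _ _ → R⇒closure , closure⇒R
  where
  module R = IsStrictPartialOrder spo

  oriented : ∃ λ c → ChoiceRel c ⇒ R
  oriented = orientation R λ y≡x+1 → Sum.map proj₁ proj₁ (proj₂ (proj₂ hasse _ _) (inj₁ y≡x+1))

  c : Fin n → Bool
  c = proj₁ oriented
  c⊆R : ChoiceRel c ⇒ R
  c⊆R = proj₂ oriented

  closure⇒R : TransClosure (ChoiceRel c) ⇒ R
  closure⇒R rs = transitive⁻ R R.trans (TransClosure-map c⊆R rs)

  Covers⇒Monotone : Covers R ⇒ Monotone c
  Covers⇒Monotone cov =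
    ChoiceRel⇒Monotone (ChoiceRel-complete R.asym c⊆R (proj₁ (proj₂ hasse _ _) (inj₁ cov)) (proj₁ cov))

  -- R x y is a cover or factors through some z only up to double negation;
  -- decidability of Monotone c removes it
  R⇒Monotone : ∀ {x y} → Acc (flip R) x → Acc R y → R x y → Monotone c x y
  R⇒Monotone {x} {y} (acc above-x) (acc below-y) x<y = decidable-stable (Monotone-dec x y) λ ¬m →
    ¬m (Covers⇒Monotone (x<y , λ (z , x<z , z<y) →
      ¬m (Monotone-trans (R⇒Monotone (acc above-x) (below-y z<y) x<z)
                         (R⇒Monotone (above-x x<z) (acc below-y) z<y))))

  R⇒closure : R ⇒ TransClosure (ChoiceRel c)
  R⇒closure x<y = Monotone⇒closure (R⇒Monotone (spo-noetherian spo _) (spo-wellFounded spo _) x<y)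

module _ {R : Rel (Fin n) 0ℓ} where

  IsChoiceClosure⇒HassePathOrder : IsChoiceClosure R → HassePathOrder R
  IsChoiceClosure⇒HassePathOrder (c , R≐closure) =
    HassePathOrder-resp-≐ (≐-trans R≐closure closure≐Monotone) Monotone-HassePathOrder

  InPP⇒IsChoiceClosure : InPP R → IsChoiceClosure R
  InPP⇒IsChoiceClosure (σ , R≐p) =
    proj₁ (orientationOf σ) , ≐-trans R≐p (p≐closure σ (proj₂ (orientationOf σ)))

  IsChoiceClosure⇒InPP : IsChoiceClosure R → InPP R
  IsChoiceClosure⇒InPP (c , R≐closure) =
    proj₁ (orderingOf c) , ≐-trans R≐closure (≐-sym (p≐closure (proj₁ (orderingOf c)) (proj₂ (orderingOf c))))

proposition3p6 : (n : ℕ) → 1 ≤ n → (R : Rel (Fin n) 0ℓ) →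
    ((InPP R → HassePathOrder R) × (HassePathOrder R → InPP R))
    × ((InPP R → Σ (Fin n → Bool) λ c → R ≐ TransClosure (ChoiceRel c))
    × ((Σ (Fin n → Bool) λ c → R ≐ TransClosure (ChoiceRel c)) → InPP R))
proposition3p6 n _ R =
  ( IsChoiceClosure⇒HassePathOrder ∘ InPP⇒IsChoiceClosure
  , IsChoiceClosure⇒InPP ∘ HassePathOrder⇒IsChoiceClosure )
  , ( InPP⇒IsChoiceClosure
    , IsChoiceClosure⇒InPP )
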